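{- Let $t$ be a positive integer with $t\equiv \mathfrak t\pmod{2730}$ for some $\mathfrak t\in\{131,1361\}$. Then $659_2^{(2;t)}=659\cdot(2^{12t}-1)/(2^{12}-1)$ is a Sierpiński number.
   Context: For integers $b\ge2$, $k\ge1$, $t\ge1$ and $z\ge0$, the $b$-repstring is $k_b^{(z;t)}=k\,(b^{(z+\ell)t}-1)/(b^{z+\ell}-1)$ where $\ell=\lfloor\log_b k\rfloor+1$ (the base-$b$ representation of $k$ repeated $t$ times with $z$ zeros inserted between consecutive copies); for $k=659$, $b=2$ one has $\ell=10$. A Sierpiński number is an odd positive integer $k$ such that $k\cdot 2^n+1$ is composite for all positive integers $n$. -}

module Defs where

open import Data.Nat using (ℕ; zero; suc; _+_; _*_; _∸_; _^_; _<_; _≤_)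
open import Data.Nat.DivMod using (_/_)
open import Data.Nat.Logarithm using (⌊log₂_⌋)
open import Data.Nat.Primality using (Composite)
open import Data.Nat.Divisibility using (_∣_)
open import Data.Product using (_×_)
open import Data.Empty using (⊥)
open import Relation.Nullary using (¬_)

_÷_ : ℕ → ℕ → ℕ
m ÷ zero  = 0
m ÷ suc n = m / suc n

binLen : ℕ → ℕ
binLen k = ⌊log₂ k ⌋ + 1

repstring₂ : (k z t : ℕ) → ℕ
repstring₂ k z t =
  (k * (2 ^ ((z + binLen k) * t) ∸ 1)) ÷ (2 ^ (z + binLen k) ∸ 1)

Odd : ℕ → Set
Odd k = ¬ (2 ∣ k)

Sierpinski : ℕ → Set
Sierpinski k = Odd k × (0 < k) × (∀ n → 1 ≤ n → Composite (k * 2 ^ n + 1))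

-- Write K = 659 R_t with R_t = (4096^t − 1)/4095 the base-4096 repunit, and let
-- N = 3·5·7·13·17·241, a divisor of 2^24 − 1.  Modulo N the powers 2^n have
-- period 24 and the repunits R_t have period 2730, so K·2^n + 1 mod N only depends
-- on (t mod 2730, n mod 24).  For t mod 2730 ∈ {131, 1361} a direct computation
-- shows that each of the 24 numbers 659·R_r·2^j + 1 has a prime factor in
-- {3, 5, 7, 13, 17, 241}; that prime then divides K·2^n + 1, which exceeds it.
module Submission where

open import Defs
open import Data.Nat using (ℕ; zero; suc; _+_; _*_; _^_; _∸_; _/_; _%_; _<_; _≤_; s≤s; z<s; _<?_; _≤?_;
                            NonZero; >-nonZero; n>1⇒nonTrivial; nonTrivial⇒nonZero)
open import Data.Nat.Properties
open import Data.Nat.DivMod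
open import Data.Nat.Divisibility
open import Data.Nat.Logarithm using (⌊log₂_⌋)
open import Data.Nat.Primality using (Composite; composite; prime?; euclidsLemma)
open import Data.Nat.ListAction using (product)
open import Data.Nat.ListAction.Properties using (∈⇒∣product)
open import Data.Nat.Tactic.RingSolver using (solve-∀)
open import Data.List using (List; []; _∷_)
open import Data.List.Membership.Propositional using (find)
open import Data.List.Relation.Unary.All as All using (All; all?)
open import Data.List.Relation.Unary.Any using (Any; any?)
open import Data.Product using (_×_; _,_)
open import Data.Sum using (_⊎_; inj₁; inj₂; [_,_])
open import Relation.Nullary.Negation using (contradiction)
open import Relation.Nullary.Decidable using (Dec; from-yes; from-no; _×-dec_)
open import Relation.Binary.PropositionalEquality using (_≡_; refl; sym; trans; cong; cong₂; subst; module ≡-Reasoning)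

module _ {m : ℕ} .{{_ : NonZero m}} where

  +-cong-% : ∀ {a b c d} → a % m ≡ b % m → c % m ≡ d % m → (a + c) % m ≡ (b + d) % m
  +-cong-% {a} {b} {c} {d} a≡b c≡d = begin
    (a + c) % m             ≡⟨ %-distribˡ-+ a c m ⟩
    (a % m + c % m) % m     ≡⟨ cong₂ (λ x y → (x + y) % m) a≡b c≡d ⟩
    (b % m + d % m) % m     ≡⟨ %-distribˡ-+ b d m ⟨
    (b + d) % m             ∎
    where open ≡-Reasoning

  *-cong-% : ∀ {a b c d} → a % m ≡ b % m → c % m ≡ d % m → (a * c) % m ≡ (b * d) % m
  *-cong-% {a} {b} {c} {d} a≡b c≡d = begin
    (a * c) % m             ≡⟨ %-distribˡ-* a c m ⟩
    (a % m * (c % m)) % m   ≡⟨ cong₂ (λ x y → (x * y) % m) a≡b c≡d ⟩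
    (b % m * (d % m)) % m   ≡⟨ %-distribˡ-* b d m ⟨
    (b * d) % m             ∎
    where open ≡-Reasoning

  ^-cong-% : ∀ {a b} → a % m ≡ b % m → ∀ n → a ^ n % m ≡ b ^ n % m
  ^-cong-% a≡b zero    = refl
  ^-cong-% a≡b (suc n) = *-cong-% a≡b (^-cong-% a≡b n)

  ∣-resp-% : ∀ {d a b} .{{_ : NonZero d}} → d ∣ m → a % m ≡ b % m → d ∣ b → d ∣ a
  ∣-resp-% {d} {a} {b} d∣m a≡b d∣b = m%n≡0⇒n∣m a d (begin
    a % d         ≡⟨ m∣n⇒o%n%m≡o%m d m a d∣m ⟨
    a % m % d     ≡⟨ cong (_% d) a≡b ⟩
    b % m % d     ≡⟨ m∣n⇒o%n%m≡o%m d m b d∣m ⟩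
    b % d         ≡⟨ n∣m⇒m%n≡0 b d d∣b ⟩
    0             ∎)
    where open ≡-Reasoning

  ^-%-periodic : ∀ {b} P .{{_ : NonZero P}} → b ^ P % m ≡ 1 % m → ∀ n → b ^ n % m ≡ b ^ (n % P) % m
  ^-%-periodic {b} P bᴾ≡1 n = begin
    b ^ n % m                               ≡⟨ cong (λ e → b ^ e % m) (m≡m%n+[m/n]*n n P) ⟩
    b ^ (n % P + n / P * P) % m             ≡⟨ cong (_% m) (^-distribˡ-+-* b (n % P) (n / P * P)) ⟩
    (b ^ (n % P) * b ^ (n / P * P)) % m     ≡⟨ *-cong-% {b ^ (n % P)} refl b^[n/P*P]≡1 ⟩
    (b ^ (n % P) * 1) % m                   ≡⟨ cong (_% m) (*-identityʳ (b ^ (n % P))) ⟩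
    b ^ (n % P) % m                         ∎
    where
    open ≡-Reasoning
    b^[n/P*P]≡1 : b ^ (n / P * P) % m ≡ 1 % m
    b^[n/P*P]≡1 = begin
      b ^ (n / P * P) % m     ≡⟨ cong (λ e → b ^ e % m) (*-comm (n / P) P) ⟩
      b ^ (P * (n / P)) % m   ≡⟨ cong (_% m) (^-*-assoc b P (n / P)) ⟨
      (b ^ P) ^ (n / P) % m   ≡⟨ ^-cong-% bᴾ≡1 (n / P) ⟩
      1 ^ (n / P) % m         ≡⟨ cong (_% m) (^-zeroˡ (n / P)) ⟩
      1 % m                   ∎

repunit : ℕ → ℕ → ℕ
repunit b zero    = 0
repunit b (suc t) = 1 + b * repunit b t

repunit-+ : ∀ b s t → repunit b (s + t) ≡ repunit b s + b ^ s * repunit b t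
repunit-+ b zero    t = sym (*-identityˡ (repunit b t))
repunit-+ b (suc s) t = begin
  1 + b * repunit b (s + t)                          ≡⟨ cong (λ x → 1 + b * x) (repunit-+ b s t) ⟩
  1 + b * (repunit b s + b ^ s * repunit b t)        ≡⟨ expand b (repunit b s) (b ^ s) (repunit b t) ⟩
  1 + b * repunit b s + b * b ^ s * repunit b t      ∎
  where
  open ≡-Reasoning
  expand : ∀ b r p u → 1 + b * (r + p * u) ≡ 1 + b * r + b * p * u
  expand = solve-∀

repunit-geometric : ∀ b t → suc b ^ t ≡ 1 + b * repunit (suc b) t
repunit-geometric b zero    = cong suc (sym (*-zeroʳ b))
repunit-geometric b (suc t) = begin
  suc b * suc b ^ t                   ≡⟨ cong (suc b *_) (repunit-geometric b t) ⟩
  suc b * (1 + b * repunit (suc b) t) ≡⟨ identity b (repunit (suc b) t) ⟩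
  1 + b * repunit (suc b) (suc t)     ∎
  where
  open ≡-Reasoning
  identity : ∀ b r → (1 + b) * (1 + b * r) ≡ 1 + b * (1 + (1 + b) * r)
  identity = solve-∀

∣repunit-periodic : ∀ {m b} P → m ∣ repunit b P → ∀ q → m ∣ repunit b (q * P)
∣repunit-periodic P m∣Rᴾ zero    = _ ∣0
∣repunit-periodic {m} {b} P m∣Rᴾ (suc q) =
  subst (m ∣_) (sym (repunit-+ b P (q * P)))
        (∣m∣n⇒∣m+n m∣Rᴾ (∣n⇒∣m*n (b ^ P) (∣repunit-periodic P m∣Rᴾ q)))

repunit-%-periodic : ∀ {m b} .{{_ : NonZero m}} P .{{_ : NonZero P}} → m ∣ repunit b P →
                     ∀ t → repunit b t % m ≡ repunit b (t % P) % m
repunit-%-periodic {m} {b} P m∣Rᴾ t = begin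
  repunit b t % m                                                   ≡⟨ cong (λ s → repunit b s % m) (m≡m%n+[m/n]*n t P) ⟩
  repunit b (t % P + t / P * P) % m                                 ≡⟨ cong (_% m) (repunit-+ b (t % P) (t / P * P)) ⟩
  (repunit b (t % P) + b ^ (t % P) * repunit b (t / P * P)) % m     ≡⟨ %-remove-+ʳ (repunit b (t % P)) (∣n⇒∣m*n (b ^ (t % P)) (∣repunit-periodic P m∣Rᴾ (t / P))) ⟩
  repunit b (t % P) % m                                             ∎
  where open ≡-Reasoning

geometric-quotient : ∀ k B → 1 < B → ∀ t → (k * (B ^ t ∸ 1)) ÷ (B ∸ 1) ≡ k * repunit B t
geometric-quotient k (suc (suc c)) _ t = begin
  (k * (suc (suc c) ^ t ∸ 1)) / suc c     ≡⟨ cong (λ x → (k * (x ∸ 1)) / suc c) (repunit-geometric (suc c) t) ⟩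
  (k * (suc c * R)) / suc c               ≡⟨ cong (_/ suc c) (*-comm-middle k (suc c) R) ⟩
  (k * R * suc c) / suc c                 ≡⟨ m*n/n≡m (k * R) (suc c) ⟩
  k * R                                   ∎
  where
  open ≡-Reasoning
  R = repunit (suc (suc c)) t
  *-comm-middle : ∀ x y z → x * (y * z) ≡ x * z * y
  *-comm-middle = solve-∀
geometric-quotient k (suc zero) (s≤s ()) t

repstring₂≡*repunit : ∀ k z t → repstring₂ k z t ≡ k * repunit (2 ^ (z + binLen k)) t
repstring₂≡*repunit k z t = begin
  (k * (2 ^ (w * t) ∸ 1)) ÷ (2 ^ w ∸ 1)     ≡⟨ cong (λ x → (k * (x ∸ 1)) ÷ (2 ^ w ∸ 1)) (^-*-assoc 2 w t) ⟨
  (k * ((2 ^ w) ^ t ∸ 1)) ÷ (2 ^ w ∸ 1)     ≡⟨ geometric-quotient k (2 ^ w) 1<2^w t ⟩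
  k * repunit (2 ^ w) t                      ∎
  where
  open ≡-Reasoning
  w = z + binLen k
  1<2^w : 1 < 2 ^ w
  1<2^w = ^-monoʳ-< 2 ≤-refl (≤-trans (m≤n+m 1 ⌊log₂ k ⌋) (m≤n+m (binLen k) z))

repunit≢0 : ∀ b t .{{_ : NonZero t}} → NonZero (repunit b t)
repunit≢0 b (suc t) = _

odd-* : ∀ {m n} → Odd m → Odd n → Odd (m * n)
odd-* {m} {n} m-odd n-odd 2∣mn = [ m-odd , n-odd ] (euclidsLemma m n (from-yes (prime? 2)) 2∣mn)

repunit-odd : ∀ {b} → 2 ∣ b → ∀ t .{{_ : NonZero t}} → Odd (repunit b t)
repunit-odd {b} 2∣b (suc t) 2∣R = contradiction (∣1⇒≡1 2∣1) λ ()
  where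
  2∣1 : 2 ∣ 1
  2∣1 = ∣m+n∣m⇒∣n (subst (2 ∣_) (+-comm 1 (b * repunit b t)) 2∣R) (∣m⇒∣m*n (repunit b t) 2∣b)

composite-by-covering : ∀ {ps c x y} .{{_ : NonZero (product ps)}} →
                        All (λ p → 1 < p × p ≤ c) ps → c < x →
                        x % product ps ≡ y % product ps → Any (_∣ y) ps → Composite x
composite-by-covering {ps} covering c<x x≡y y-covered
  with p , p∈ps , p∣y ← find y-covered
  with 1<p , p≤c ← All.lookup covering p∈ps =
  let instance
        _ = n>1⇒nonTrivial 1<p
        _ = nonTrivial⇒nonZero p
  in composite (≤-<-trans p≤c c<x) (∣-resp-% (∈⇒∣product p∈ps) x≡y p∣y)

k*repunit*2ⁿ+1-%-periodic : ∀ {m} .{{_ : NonZero m}} k {b} P .{{_ : NonZero P}} Q .{{_ : NonZero Q}} →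
                            m ∣ repunit b P → 2 ^ Q % m ≡ 1 % m → ∀ t n →
                            (k * repunit b t * 2 ^ n + 1) % m ≡ (k * repunit b (t % P) * 2 ^ (n % Q) + 1) % m
k*repunit*2ⁿ+1-%-periodic k P Q m∣Rᴾ 2^Q≡1 t n =
  +-cong-% (*-cong-% (*-cong-% {a = k} {b = k} refl (repunit-%-periodic P m∣Rᴾ t)) (^-%-periodic Q 2^Q≡1 n)) refl

k<k*repunit*2ⁿ+1 : ∀ k b t .{{_ : NonZero t}} n → k < k * repunit b t * 2 ^ n + 1
k<k*repunit*2ⁿ+1 k b t n = ≤-<-trans k≤k*R*2ⁿ (m<m+n (k * R * 2 ^ n) z<s)
  where
  R = repunit b t
  k≤k*R*2ⁿ : k ≤ k * R * 2 ^ n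
  k≤k*R*2ⁿ = m≤n⇒m≤n*o (2 ^ n) {{m^n≢0 2 n}} (m≤m*n k R {{repunit≢0 b t}})

k*repunit*2ⁿ+1-composite : ∀ {ps} .{{_ : NonZero (product ps)}} k b P .{{_ : NonZero P}} Q .{{_ : NonZero Q}} →
                           All (λ p → 1 < p × p ≤ k) ps → product ps ∣ repunit b P →
                           2 ^ Q % product ps ≡ 1 % product ps →
                           ∀ t .{{_ : NonZero t}} →
                           (∀ {j} → j < Q → Any (_∣ k * repunit b (t % P) * 2 ^ j + 1) ps) →
                           ∀ n → Composite (k * repunit b t * 2 ^ n + 1)
k*repunit*2ⁿ+1-composite k b P Q covering ∏ps∣Rᴾ 2^Q≡1 t residues-covered n =
  composite-by-covering covering (k<k*repunit*2ⁿ+1 k b t n)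
    (k*repunit*2ⁿ+1-%-periodic k P Q ∏ps∣Rᴾ 2^Q≡1 t n) (residues-covered (m%n<n n Q))

coveringPrimes : List ℕ
coveringPrimes = 3 ∷ 5 ∷ 7 ∷ 13 ∷ 17 ∷ 241 ∷ []

coveringPrimes-nontrivial-≤659 : All (λ p → 1 < p × p ≤ 659) coveringPrimes
coveringPrimes-nontrivial-≤659 = from-yes (all? (λ p → 1 <? p ×-dec p ≤? 659) coveringPrimes)

∏coveringPrimes∣repunit[4096,2730] : product coveringPrimes ∣ repunit 4096 2730
∏coveringPrimes∣repunit[4096,2730] = from-yes (product coveringPrimes ∣? repunit 4096 2730)

2^24≡1-mod-∏coveringPrimes : 2 ^ 24 % product coveringPrimes ≡ 1 % product coveringPrimes
2^24≡1-mod-∏coveringPrimes = refl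

coverage : ∀ r → Dec (∀ {j} → j < 24 → Any (_∣ 659 * repunit 4096 r * 2 ^ j + 1) coveringPrimes)
coverage r = allUpTo? (λ j → any? (_∣? 659 * repunit 4096 r * 2 ^ j + 1) coveringPrimes) 24

covered : ∀ r → r ≡ 131 ⊎ r ≡ 1361 → ∀ {j} → j < 24 → Any (_∣ 659 * repunit 4096 r * 2 ^ j + 1) coveringPrimes
covered _ (inj₁ refl) = from-yes (coverage 131)
covered _ (inj₂ refl) = from-yes (coverage 1361)

-- Rewriting the base separately keeps the conversion checker from unfolding 659 * _.
repstring₂-659-2 : ∀ t → repstring₂ 659 2 t ≡ 659 * repunit 4096 t
repstring₂-659-2 t = trans (repstring₂≡*repunit 659 2 t) (cong (λ B → 659 * repunit B t) 2^[2+ℓ]≡4096)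
  where
  2^[2+ℓ]≡4096 : 2 ^ (2 + binLen 659) ≡ 4096
  2^[2+ℓ]≡4096 = refl

theorem4p3 : (t : ℕ) → 0 < t → (t % 2730 ≡ 131 ⊎ t % 2730 ≡ 1361) →
    Sierpinski (repstring₂ 659 2 t)
theorem4p3 t 0<t t%2730≡r = subst Sierpinski (sym (repstring₂-659-2 t))
  ( odd-* (from-no (2 ∣? 659)) (repunit-odd (from-yes (2 ∣? 4096)) t)
  , ≤-trans z<s (m≤m*n 659 (repunit 4096 t) {{repunit≢0 4096 t}})
  , λ n _ → k*repunit*2ⁿ+1-composite 659 4096 2730 24
              coveringPrimes-nontrivial-≤659 ∏coveringPrimes∣repunit[4096,2730] 2^24≡1-mod-∏coveringPrimes
              t (covered (t % 2730) t%2730≡r) n )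
  where instance _ = >-nonZero 0<t
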